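{- Let $m\ge 1$ be an integer. Define polynomials $P_k^{(m)}(x)\in\mathbb{Z}[x]$, $k\ge 0$, by the expansion in $\mathbb{Z}[x][[y]]$ $$\sum_{k=0}^\infty P_k^{(m)}(x)\,y^k=\frac{1+(x-1)y}{1-y+x(1-x)^m y^{m+1}},$$ and set $P_k^{(m)}=0$ for $k<0$. For each integer $k\ge 0$ let $F_k^+(x)=\sum_{n=0}^\infty\binom{n}{k}_m x^n$ and $F_k^-(x)=\sum_{n=1}^\infty\binom{ -n}{k}_m x^n$ (formal power series in $x$). Then $$F_k^+(x)=\left(\frac{1}{1-x}\right)^{k+1}P_k^{(m)}(x),\qquad F_k^-(x)=(-1)^k\left(\frac{x}{1-x}\right)^{k+1}P_k^{(m)}(x^{ -1}).$$ Moreover $P_0^{(m)}(x)=1$, $P_1^{(m)}(x)=x$, the polynomials satisfy $P_k^{(m)}(x)=P_{k-1}^{(m)}(x)-x(1-x)^mP_{k-m-1}^{(m)}(x)$ for all $k\ge 2$, and $P_k^{(m)}(x)=x$ for all $1\le k\le m$.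
   Context: For an integer $m\ge 1$ let $p_m(t)=1+t+\cdots+t^m$. For $n\in\mathbb{Z}$ and integer $k\ge 0$, $\binom{n}{k}_m$ denotes the coefficient of $t^k$ in the formal power series $p_m(t)^n\in\mathbb{Z}[[t]]$ (for $n<0$, the expansion of $1/p_m(t)^{ -n}$), and $\binom{n}{k}_m=0$ for $k<0$. Note $\deg P_k^{(m)}\le k$, so $x^{k+1}P_k^{(m)}(x^{ -1})$ is a polynomial. -}

module Defs where

open import Data.Nat as ℕ using (ℕ; zero; suc; _∸_; _≤ᵇ_; _≡ᵇ_)
open import Data.Integer as ℤ using (ℤ; +_; -[1+_])
open import Data.Bool using (if_then_else_)
open import Relation.Binary.PropositionalEquality using (_≡_)

module PowerSeries {A : Set} (0# 1# : A) (_⊕_ _⊗_ : A → A → A) (⊖_ : A → A) where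

  Ser : Set
  Ser = ℕ → A

  sumTo : (ℕ → A) → ℕ → A
  sumTo f zero    = f 0
  sumTo f (suc n) = sumTo f n ⊕ f (suc n)

  zeroS oneS : Ser
  zeroS _ = 0#
  oneS zero    = 1#
  oneS (suc _) = 0#

  mono : A → ℕ → Ser
  mono c d n = if d ≡ᵇ n then c else 0#

  infixl 6 _+S_
  infixl 7 _*S_

  _+S_ : Ser → Ser → Ser
  (a +S b) n = a n ⊕ b n

  negS : Ser → Ser
  negS a n = ⊖ (a n)

  _*S_ : Ser → Ser → Ser
  (a *S b) n = sumTo (λ i → a i ⊗ b (n ∸ i)) n

  powS : Ser → ℕ → Ser
  powS a zero    = oneS
  powS a (suc n) = a *S powS a n

  -- Multiplicative inverse of a series with constant term 1:
  -- b₀ = 1,  b_n = - Σ_{i=1}^{n} a_i b_{n-i}  (n ≥ 1).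
  -- invUpTo a n agrees with the inverse at all indices ≤ n.
  invUpTo : Ser → ℕ → Ser
  invUpTo a zero    = oneS
  invUpTo a (suc n) j =
    if j ≤ᵇ n then invUpTo a n j
    else (if j ≡ᵇ suc n
          then ⊖ sumTo (λ i → a (suc i) ⊗ invUpTo a n (n ∸ i)) n
          else 0#)

  invS : Ser → Ser
  invS a n = invUpTo a n n

open PowerSeries (+ 0) (+ 1) ℤ._+_ ℤ._*_ ℤ.-_ public

_≈S_ : Ser → Ser → Set
a ≈S b = ∀ n → a n ≡ b n

infix 4 _≈S_

X : Ser
X = mono (+ 1) 1

scaleS : ℤ → Ser → Ser
scaleS c a n = c ℤ.* a n

-- ℤ[[x]][[y]]  (contains ℤ[x][[y]]); coefficients indexed by the power of y

module Y = PowerSeries zeroS oneS _+S_ _*S_ negS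

numer : Y.Ser
numer = Y._+S_ (Y.mono oneS 0) (Y.mono (X +S negS oneS) 1)

denom : ℕ → Y.Ser
denom m = Y._+S_ (Y._+S_ (Y.mono oneS 0) (Y.mono (negS oneS) 1))
                 (Y.mono (X *S powS (oneS +S negS X) m) (suc m))

P : ℕ → ℕ → Ser
P m k = Y._*S_ numer (Y.invS (denom m)) k

Pℤ : ℕ → ℤ → Ser
Pℤ m (+ k)     = P m k
Pℤ m -[1+ _ ]  = zeroS

-- m-binomial coefficients:  coefficient of t^k in p_m(t)^n, n ∈ ℤ

pm : ℕ → Ser
pm m i = if i ≤ᵇ m then + 1 else + 0

binomm : ℕ → ℤ → ℕ → ℤ
binomm m (+ n)      k = powS (pm m) n k
binomm m -[1+ n ]   k = invS (powS (pm m) (suc n)) k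

Fplus : ℕ → ℕ → Ser
Fplus m k n = binomm m (+ n) k

Fminus : ℕ → ℕ → Ser
Fminus m k zero    = + 0
Fminus m k (suc n) = binomm m -[1+ n ] k

geom : Ser
geom = invS (oneS +S negS X)

-- x^{k+1} p(x^{-1}) for a polynomial p of degree ≤ k (coefficients of p
-- above degree k+1 are ignored; deg P_k^{(m)} ≤ k)
recip : ℕ → Ser → Ser
recip k p j = if j ≤ᵇ suc k then p (suc k ∸ j) else + 0

-- The families F⁺_k, F⁻_k and the claimed right-hand sides all satisfy recurrences of the form
--   (1 - x) u_{k+1} = a u_k + b u_{k-m} + e_k    (u_j = 0 for j < 0),
-- with (a, b, e_k) = (1, -x, -[k = 0]) on the F⁺ side and (-x, 1, -x [k = 0]) on the F⁻ side, and since
-- 1 - x is invertible such a recurrence determines u from u_0.  For F± the recurrence is the coefficient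
-- of t^{k+1} in (1 - t) p_m(t)^{n+1} = (1 - t^{m+1}) p_m(t)^n, for nonnegative and for negative powers.
-- For the right-hand sides it comes from the coefficient of y^{k+1} in
-- (1 - y + x(1-x)^m y^{m+1}) Σ P_k y^k = 1 + (x-1) y; the weights (1-x)^{-(k+1)} absorb (1-x)^m when the
-- index drops by m.  On the F⁻ side the recurrence is reversed into one for x^{k+1} P_k(1/x), which is
-- where deg P_k ≤ k is needed.

module Submission where

open import Algebra.Bundles using (CommutativeRing)
open import Algebra.Solver.Ring.AlmostCommutativeRing using (fromCommutativeRing; _-Raw-AlmostCommutative⟶_)
open import Data.Bool using (Bool; true; false; T; if_then_else_)
open import Data.Empty using (⊥-elim)
open import Data.Integer as ℤ using (ℤ; +_; -[1+_])
import Data.Integer.Properties as ZP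
open import Data.Integer.Tactic.RingSolver using (solve-∀)
open import Data.Nat as ℕ using (ℕ; zero; suc; _≤_; _<_; _∸_; z≤n; s≤s; _≤ᵇ_)
open import Data.Nat.Induction using (<-rec)
import Data.Nat.Properties as ℕP
open import Data.Maybe using (just; nothing)
open import Data.Product using (_×_; _,_)
open import Data.Unit using (tt)
open import Level using (0ℓ)
open import Relation.Binary.PropositionalEquality as ≡ using (_≡_)
open import Relation.Binary.Definitions using (WeaklyDecidable)
open import Relation.Nullary using (¬_; yes; no)
import Defs

if-true : ∀ {a} {A : Set a} {b : Bool} {x y : A} → T b → (if b then x else y) ≡ x
if-true {b = true} _ = ≡.refl

if-false : ∀ {a} {A : Set a} {b : Bool} {x y : A} → ¬ T b → (if b then x else y) ≡ y
if-false {b = true}  ¬b = ⊥-elim (¬b tt)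
if-false {b = false} _  = ≡.refl

lag : {A : Set} → A → ℕ → (ℕ → A) → ℕ → A
lag z zero    u k       = u k
lag z (suc m) u zero    = z
lag z (suc m) u (suc k) = lag z m u k

lag-constant : ∀ {A : Set} (z : A) m k → lag z m (λ _ → z) k ≡ z
lag-constant z zero    k       = ≡.refl
lag-constant z (suc m) zero    = ≡.refl
lag-constant z (suc m) (suc k) = lag-constant z m k

lag-< : ∀ {A : Set} (z : A) {m k} u → k < m → lag z m u k ≡ z
lag-< z {suc m} {zero}  u _           = ≡.refl
lag-< z {suc m} {suc k} u (s≤s k<m) = lag-< z u k<m

-- Formal power series over a commutative ring

module Series {ℓ} (R : CommutativeRing 0ℓ ℓ) where

  open CommutativeRing R hiding (zero)
  open Defs.PowerSeries 0# 1# _+_ _*_ -_ public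
  open import Relation.Binary.Reasoning.Setoid setoid

  infix 4 _≋_

  record _≋_ (a b : Ser) : Set ℓ where
    constructor mk≋
    field coeff : ∀ n → a n ≈ b n
  open _≋_ public

  ≡⇒≈ : ∀ {x y} → x ≡ y → x ≈ y
  ≡⇒≈ ≡.refl = refl

  ≡⇒≋ : ∀ {a b} → a ≡ b → a ≋ b
  ≡⇒≋ ≡.refl = mk≋ λ _ → refl

  sumTo-cong : ∀ {f g} n → (∀ i → i ≤ n → f i ≈ g i) → sumTo f n ≈ sumTo g n
  sumTo-cong zero    f≈g = f≈g 0 z≤n
  sumTo-cong (suc n) f≈g =
    +-cong (sumTo-cong n (λ i i≤n → f≈g i (ℕP.m≤n⇒m≤1+n i≤n))) (f≈g (suc n) ℕP.≤-refl)

  sumTo-cong′ : ∀ {f g} n → (∀ i → f i ≈ g i) → sumTo f n ≈ sumTo g n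
  sumTo-cong′ n f≈g = sumTo-cong n (λ i _ → f≈g i)

  sumTo-+ : ∀ f g n → sumTo (λ i → f i + g i) n ≈ sumTo f n + sumTo g n
  sumTo-+ f g zero    = refl
  sumTo-+ f g (suc n) = trans (+-congʳ (sumTo-+ f g n)) (+-medial _ _ _ _)
    where open import Algebra.Properties.CommutativeSemigroup +-commutativeSemigroup using () renaming (interchange to +-medial)

  sumTo-*ˡ : ∀ x f n → x * sumTo f n ≈ sumTo (λ i → x * f i) n
  sumTo-*ˡ x f zero    = refl
  sumTo-*ˡ x f (suc n) = trans (distribˡ x _ _) (+-congʳ (sumTo-*ˡ x f n))

  sumTo-*ʳ : ∀ x f n → sumTo f n * x ≈ sumTo (λ i → f i * x) n
  sumTo-*ʳ x f zero    = refl
  sumTo-*ʳ x f (suc n) = trans (distribʳ x _ _) (+-congʳ (sumTo-*ʳ x f n))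

  sumTo-0 : ∀ {f} n → (∀ i → f i ≈ 0#) → sumTo f n ≈ 0#
  sumTo-0 zero    f≈0 = f≈0 0
  sumTo-0 (suc n) f≈0 = trans (+-cong (sumTo-0 n f≈0) (f≈0 (suc n))) (+-identityˡ 0#)

  sumTo-suc : ∀ f n → sumTo f (suc n) ≈ f 0 + sumTo (λ i → f (suc i)) n
  sumTo-suc f zero    = refl
  sumTo-suc f (suc n) = trans (+-congʳ (sumTo-suc f n)) (+-assoc _ _ _)

  sumTo-reverse : ∀ f n → sumTo f n ≈ sumTo (λ i → f (n ∸ i)) n
  sumTo-reverse f zero    = refl
  sumTo-reverse f (suc n) = begin
    sumTo f n + f (suc n)                         ≈⟨ +-comm _ _ ⟩
    f (suc n) + sumTo f n                         ≈⟨ +-congˡ (sumTo-reverse f n) ⟩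
    f (suc n) + sumTo (λ i → f (n ∸ i)) n         ≈⟨ sumTo-suc (λ i → f (suc n ∸ i)) n ⟨
    sumTo (λ i → f (suc n ∸ i)) (suc n)           ∎

  sumTo-triangle : ∀ (h : ℕ → ℕ → Carrier) n →
    sumTo (λ s → sumTo (λ i → h i s) s) n ≈ sumTo (λ i → sumTo (λ j → h i (i ℕ.+ j)) (n ∸ i)) n
  sumTo-triangle h zero    = refl
  sumTo-triangle h (suc n) = begin
      sumTo (λ s → sumTo (λ i → h i s) s) n + (sumTo (λ i → h i (suc n)) n + h (suc n) (suc n))
    ≈⟨ +-assoc _ _ _ ⟨
      (sumTo (λ s → sumTo (λ i → h i s) s) n + sumTo (λ i → h i (suc n)) n) + h (suc n) (suc n)
    ≈⟨ +-cong (trans (+-congʳ (sumTo-triangle h n)) (sym (sumTo-+ _ _ n)))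
              (≡⇒≈ (≡.cong (h (suc n)) (≡.sym (ℕP.+-identityʳ (suc n))))) ⟩
      sumTo (λ i → sumTo (λ j → h i (i ℕ.+ j)) (n ∸ i) + h i (suc n)) n + h (suc n) (suc n ℕ.+ 0)
    ≈⟨ +-cong (sumTo-cong n extend)
              (≡⇒≈ (≡.cong (sumTo (λ j → h (suc n) (suc n ℕ.+ j))) (≡.sym (ℕP.n∸n≡0 n)))) ⟩
      sumTo (λ i → sumTo (λ j → h i (i ℕ.+ j)) (suc n ∸ i)) (suc n)
    ∎
    where
    extend : ∀ i → i ≤ n →
      sumTo (λ j → h i (i ℕ.+ j)) (n ∸ i) + h i (suc n) ≈ sumTo (λ j → h i (i ℕ.+ j)) (suc n ∸ i)
    extend i i≤n rewrite ℕP.+-∸-assoc 1 i≤n =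
      +-congˡ (≡⇒≈ (≡.cong (h i) (≡.trans (≡.cong suc (≡.sym (ℕP.m+[n∸m]≡n i≤n)))
                                          (≡.sym (ℕP.+-suc i (n ∸ i))))))

  ≋-refl : ∀ {a} → a ≋ a
  ≋-refl = mk≋ λ _ → refl

  ≋-sym : ∀ {a b} → a ≋ b → b ≋ a
  ≋-sym a≋b = mk≋ λ n → sym (coeff a≋b n)

  ≋-trans : ∀ {a b c} → a ≋ b → b ≋ c → a ≋ c
  ≋-trans a≋b b≋c = mk≋ λ n → trans (coeff a≋b n) (coeff b≋c n)

  *S-cong : ∀ {a a′ b b′} → a ≋ a′ → b ≋ b′ → a *S b ≋ a′ *S b′
  *S-cong a≋a′ b≋b′ = mk≋ λ n → sumTo-cong′ n (λ i → *-cong (coeff a≋a′ i) (coeff b≋b′ (n ∸ i)))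

  *S-congˡ : ∀ a {b b′} → b ≋ b′ → a *S b ≋ a *S b′
  *S-congˡ a = *S-cong (≋-refl {a})

  *S-congʳ : ∀ b {a a′} → a ≋ a′ → a *S b ≋ a′ *S b
  *S-congʳ b a≋a′ = *S-cong a≋a′ (≋-refl {b})

  +S-cong : ∀ {a a′ b b′} → a ≋ a′ → b ≋ b′ → a +S b ≋ a′ +S b′
  +S-cong a≋a′ b≋b′ = mk≋ λ n → +-cong (coeff a≋a′ n) (coeff b≋b′ n)

  +S-congˡ : ∀ a {b b′} → b ≋ b′ → a +S b ≋ a +S b′
  +S-congˡ a = +S-cong (≋-refl {a})

  +S-congʳ : ∀ b {a a′} → a ≋ a′ → a +S b ≋ a′ +S b
  +S-congʳ b a≋a′ = +S-cong a≋a′ (≋-refl {b})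

  negS-cong : ∀ {a a′} → a ≋ a′ → negS a ≋ negS a′
  negS-cong a≋a′ = mk≋ λ n → -‿cong (coeff a≋a′ n)

  *S-comm : ∀ a b → a *S b ≋ b *S a
  *S-comm a b = mk≋ λ n → begin
    sumTo (λ i → a i * b (n ∸ i)) n                 ≈⟨ sumTo-reverse _ n ⟩
    sumTo (λ i → a (n ∸ i) * b (n ∸ (n ∸ i))) n     ≈⟨ sumTo-cong n (λ i i≤n →
                                                         trans (*-comm _ _) (*-congʳ (≡⇒≈ (≡.cong b (ℕP.m∸[m∸n]≡n i≤n))))) ⟩
    sumTo (λ i → b i * a (n ∸ i)) n                 ∎

  *S-distribʳ : ∀ a b c → (b +S c) *S a ≋ b *S a +S c *S a
  *S-distribʳ a b c = mk≋ λ n → trans (sumTo-cong′ n (λ i → distribʳ _ _ _)) (sumTo-+ _ _ n)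

  *S-assoc : ∀ a b c → (a *S b) *S c ≋ a *S (b *S c)
  *S-assoc a b c = mk≋ λ n → begin
      sumTo (λ s → sumTo (λ i → a i * b (s ∸ i)) s * c (n ∸ s)) n
    ≈⟨ sumTo-cong′ n (λ s → sumTo-*ʳ _ _ s) ⟩
      sumTo (λ s → sumTo (λ i → (a i * b (s ∸ i)) * c (n ∸ s)) s) n
    ≈⟨ sumTo-triangle (λ i s → (a i * b (s ∸ i)) * c (n ∸ s)) n ⟩
      sumTo (λ i → sumTo (λ j → (a i * b ((i ℕ.+ j) ∸ i)) * c (n ∸ (i ℕ.+ j))) (n ∸ i)) n
    ≈⟨ sumTo-cong′ n (λ i → sumTo-cong′ (n ∸ i) (λ j → trans (*-assoc _ _ _)
         (*-congˡ (*-cong (≡⇒≈ (≡.cong b (ℕP.m+n∸m≡n i j)))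
                          (≡⇒≈ (≡.cong c (≡.sym (ℕP.∸-+-assoc n i j)))))))) ⟩
      sumTo (λ i → sumTo (λ j → a i * (b j * c (n ∸ i ∸ j))) (n ∸ i)) n
    ≈⟨ sumTo-cong′ n (λ i → sym (sumTo-*ˡ _ _ (n ∸ i))) ⟩
      sumTo (λ i → a i * sumTo (λ j → b j * c (n ∸ i ∸ j)) (n ∸ i)) n
    ∎

  *S-identityˡ : ∀ a → oneS *S a ≋ a
  *S-identityˡ a = mk≋ λ where
    zero    → *-identityˡ _
    (suc n) → begin
      sumTo (λ i → oneS i * a (suc n ∸ i)) (suc n)        ≈⟨ sumTo-suc _ n ⟩
      1# * a (suc n) + sumTo (λ i → 0# * a (n ∸ i)) n     ≈⟨ +-cong (*-identityˡ _) (sumTo-0 n (λ _ → zeroˡ _)) ⟩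
      a (suc n) + 0#                                      ≈⟨ +-identityʳ _ ⟩
      a (suc n)                                           ∎

  commutativeRing : CommutativeRing 0ℓ ℓ
  commutativeRing = record
    { Carrier = Ser ; _≈_ = _≋_ ; _+_ = _+S_ ; _*_ = _*S_ ; -_ = negS ; 0# = zeroS ; 1# = oneS
    ; isCommutativeRing = record
      { isRing = record
        { +-isAbelianGroup = record
          { isGroup = record
            { isMonoid = record
              { isSemigroup = record
                { isMagma = record
                  { isEquivalence = record { refl = ≋-refl ; sym = ≋-sym ; trans = ≋-trans }
                  ; ∙-cong = +S-cong }
                ; assoc = λ a b c → mk≋ λ n → +-assoc (a n) (b n) (c n) }
              ; identity = (λ a → mk≋ λ n → +-identityˡ (a n)) , (λ a → mk≋ λ n → +-identityʳ (a n)) }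
            ; inverse = (λ a → mk≋ λ n → -‿inverseˡ (a n)) , (λ a → mk≋ λ n → -‿inverseʳ (a n))
            ; ⁻¹-cong = negS-cong }
          ; comm = λ a b → mk≋ λ n → +-comm (a n) (b n) }
        ; *-cong = *S-cong
        ; *-assoc = *S-assoc
        ; *-identity = *S-identityˡ , (λ a → ≋-trans (*S-comm a oneS) (*S-identityˡ a))
        ; distrib = (λ a b c → ≋-trans (*S-comm a (b +S c)) (≋-trans (*S-distribʳ a b c)
                                 (+S-cong (*S-comm b a) (*S-comm c a))))
                  , *S-distribʳ }
      ; *-comm = *S-comm } }

  mono-*S-lag : ∀ c m a k → (mono c m *S a) k ≈ c * lag 0# m a k
  mono-*S-lag c zero    a zero    = refl
  mono-*S-lag c zero    a (suc k) = begin
    sumTo (λ i → mono c 0 i * a (suc k ∸ i)) (suc k)   ≈⟨ sumTo-suc _ k ⟩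
    c * a (suc k) + sumTo (λ i → 0# * a (k ∸ i)) k     ≈⟨ +-congˡ (sumTo-0 k (λ _ → zeroˡ _)) ⟩
    c * a (suc k) + 0#                                 ≈⟨ +-identityʳ _ ⟩
    c * a (suc k)                                      ∎
  mono-*S-lag c (suc m) a zero    = trans (zeroˡ _) (sym (zeroʳ c))
  mono-*S-lag c (suc m) a (suc k) = begin
    sumTo (λ i → mono c (suc m) i * a (suc k ∸ i)) (suc k)   ≈⟨ sumTo-suc _ k ⟩
    0# * a (suc k) + (mono c m *S a) k                      ≈⟨ +-cong (zeroˡ _) (mono-*S-lag c m a k) ⟩
    0# + c * lag 0# m a k                                   ≈⟨ +-identityˡ _ ⟩
    c * lag 0# m a k                                        ∎

  invUpTo-stable : ∀ a n j → j ≤ n → invUpTo a n j ≡ invS a j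
  invUpTo-stable a zero    .zero z≤n = ≡.refl
  invUpTo-stable a (suc n) j j≤1+n with j ℕP.≟ suc n
  ... | yes ≡.refl = ≡.refl
  ... | no j≢1+n   = ≡.trans (if-true (ℕP.≤⇒≤ᵇ j≤n)) (invUpTo-stable a n j j≤n)
    where j≤n = ℕP.≤-pred (ℕP.≤∧≢⇒< j≤1+n j≢1+n)

  invS-suc : ∀ a n → invS a (suc n) ≈ - sumTo (λ i → a (suc i) * invS a (n ∸ i)) n
  invS-suc a n = trans
    (≡⇒≈ (≡.trans (if-false (λ t → ℕP.<-irrefl ≡.refl (ℕP.≤ᵇ⇒≤ (suc n) n t))) (if-true (ℕP.≡⇒≡ᵇ n n ≡.refl))))
    (-‿cong (sumTo-cong n (λ i _ → *-congˡ (≡⇒≈ (invUpTo-stable a n (n ∸ i) (ℕP.m∸n≤m n i))))))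

  *S-invS : ∀ a → a 0 ≈ 1# → a *S invS a ≋ oneS
  *S-invS a a₀≈1 = mk≋ λ where
    zero    → trans (*-congʳ a₀≈1) (*-identityˡ _)
    (suc n) → let S = sumTo (λ i → a (suc i) * invS a (n ∸ i)) n in begin
      sumTo (λ i → a i * invS a (suc n ∸ i)) (suc n)   ≈⟨ sumTo-suc _ n ⟩
      a 0 * invS a (suc n) + S                         ≈⟨ +-congʳ (*-cong a₀≈1 (invS-suc a n)) ⟩
      1# * - S + S                                     ≈⟨ +-congʳ (*-identityˡ _) ⟩
      - S + S                                          ≈⟨ -‿inverseˡ S ⟩
      0#                                               ∎

module ℤX = Series ZP.+-*-commutativeRing
module ℤXY = Series ℤX.commutativeRing

open Defs
open import Data.Nat using (_+_)
open import Data.Integer using (_-_; _^_)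
open ℤX using (_≋_; mk≋; coeff; ≋-refl; ≋-sym; ≋-trans; *S-cong; *S-congˡ; *S-congʳ; +S-cong; +S-congˡ; +S-congʳ;
              negS-cong; *S-assoc; *S-comm; *S-invS)
open import Relation.Binary.Reasoning.Setoid (CommutativeRing.setoid ℤX.commutativeRing)

module ℤXRing = CommutativeRing ℤX.commutativeRing
module ℤXYRing = CommutativeRing ℤXY.commutativeRing

const : ℤ → Ser
const c = mono c 0

const-+ : ∀ a b → const (a ℤ.+ b) ≋ const a +S const b
const-+ a b = mk≋ λ { zero → ≡.refl ; (suc n) → ≡.refl }

const-* : ∀ a b → const (a ℤ.* b) ≋ const a *S const b
const-* a b = mk≋ λ { zero → ≡.refl ; (suc n) → ≡.sym (≡.trans (ℤX.mono-*S-lag a 0 (const b) (suc n)) (ZP.*-zeroʳ a)) }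

const-neg : ∀ a → const (ℤ.- a) ≋ negS (const a)
const-neg a = mk≋ λ { zero → ≡.refl ; (suc n) → ≡.refl }

oneS≋const : oneS ≋ const (+ 1)
oneS≋const = mk≋ λ { zero → ≡.refl ; (suc n) → ≡.refl }

zeroS≋const : zeroS ≋ const (+ 0)
zeroS≋const = mk≋ λ { zero → ≡.refl ; (suc n) → ≡.refl }

const-*S : ∀ c a → const c *S a ≋ scaleS c a
const-*S c a = mk≋ λ n → ℤX.mono-*S-lag c 0 a n

-- The solver interprets integer constants by embed, which sends 0 and 1 to zeroS and oneS
-- themselves, so that these occur literally in the identities it proves.
embed : ℤ → Ser
embed (+ 0) = zeroS
embed (+ 1) = oneS
embed c     = const c

embed≋const : ∀ c → embed c ≋ const c
embed≋const (+ 0)           = zeroS≋const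
embed≋const (+ 1)           = oneS≋const
embed≋const (+ suc (suc n)) = ≋-refl
embed≋const -[1+ n ]        = ≋-refl

embed-homomorphism : ℤ.+-*-rawRing -Raw-AlmostCommutative⟶ fromCommutativeRing ℤX.commutativeRing
embed-homomorphism = record
  { ⟦_⟧    = embed
  ; +-homo = λ a b → ≋-trans (embed≋const (a ℤ.+ b)) (≋-trans (const-+ a b) (≋-sym (+S-cong (embed≋const a) (embed≋const b))))
  ; *-homo = λ a b → ≋-trans (embed≋const (a ℤ.* b)) (≋-trans (const-* a b) (≋-sym (*S-cong (embed≋const a) (embed≋const b))))
  ; -‿homo = λ a → ≋-trans (embed≋const (ℤ.- a)) (≋-trans (const-neg a) (≋-sym (negS-cong (embed≋const a))))
  ; 0-homo = ≋-refl
  ; 1-homo = ≋-refl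
  }

embed-≟ : WeaklyDecidable (λ a b → embed a ≋ embed b)
embed-≟ a b with a ZP.≟ b
... | yes ≡.refl = just ≋-refl
... | no _       = nothing

open import Algebra.Solver.Ring ℤ.+-*-rawRing (fromCommutativeRing ℤX.commutativeRing) embed-homomorphism embed-≟
  using (solve; _:=_; con; _:+_; _:*_; :-_; _:-_)

X-*S-zero : ∀ a → (X *S a) 0 ≡ + 0
X-*S-zero a = ℤX.mono-*S-lag (+ 1) 1 a 0

X-*S-suc : ∀ a n → (X *S a) (suc n) ≡ a n
X-*S-suc a n = ≡.trans (ℤX.mono-*S-lag (+ 1) 1 a (suc n)) (ZP.*-identityˡ (a n))

1-X : Ser
1-X = oneS +S negS X

1-X-*S : ∀ a → 1-X *S a ≋ a +S negS (X *S a)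
1-X-*S a = solve 2 (λ x a → (con (+ 1) :- x) :* a := a :- x :* a) ≋-refl X a

1-X-*S-zero : ∀ a → (1-X *S a) 0 ≡ a 0
1-X-*S-zero a = ≡.trans (coeff (1-X-*S a) 0) (≡.trans (≡.cong (λ z → a 0 ℤ.- z) (X-*S-zero a)) (ZP.+-identityʳ (a 0)))

1-X-*S-suc : ∀ a n → (1-X *S a) (suc n) ≡ a (suc n) ℤ.- a n
1-X-*S-suc a n = ≡.trans (coeff (1-X-*S a) (suc n)) (≡.cong (λ z → a (suc n) ℤ.- z) (X-*S-suc a n))

1-X-*S-geom : 1-X *S geom ≋ oneS
1-X-*S-geom = *S-invS 1-X ≡.refl

cancel-1-X : ∀ {a b} → 1-X *S a ≋ b → a ≋ geom *S b
cancel-1-X {a} {b} 1-X*a≋b = begin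
  a                      ≈⟨ ℤX.*S-identityˡ a ⟨
  oneS *S a              ≈⟨ *S-congʳ a (≋-trans (*S-comm geom 1-X) 1-X-*S-geom) ⟨
  (geom *S 1-X) *S a     ≈⟨ *S-assoc geom 1-X a ⟩
  geom *S (1-X *S a)     ≈⟨ *S-congˡ geom 1-X*a≋b ⟩
  geom *S b              ∎

lag-coeff : ∀ m (u : ℕ → Ser) k n → lag zeroS m u k n ≡ lag (+ 0) m (λ j → u j n) k
lag-coeff zero    u k       n = ≡.refl
lag-coeff (suc m) u zero    n = ≡.refl
lag-coeff (suc m) u (suc k) n = lag-coeff m u k n

lag-cong : ∀ {u v} m k → (∀ j → j ≤ k → u j ≋ v j) → lag zeroS m u k ≋ lag zeroS m v k
lag-cong zero    k       u≋v = u≋v k ℕP.≤-refl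
lag-cong (suc m) zero    u≋v = ≋-refl
lag-cong (suc m) (suc k) u≋v = lag-cong m k (λ j j≤k → u≋v j (ℕP.m≤n⇒m≤1+n j≤k))

δ : ℕ → Ser
δ zero    = oneS
δ (suc k) = zeroS

δ-zero : ∀ k → δ k 0 ≡ oneS k
δ-zero zero    = ≡.refl
δ-zero (suc k) = ≡.refl

δ-suc : ∀ k n → δ k (suc n) ≡ + 0
δ-suc zero    n = ≡.refl
δ-suc (suc k) n = ≡.refl

record Recurrence (m : ℕ) (a b : Ser) (e u : ℕ → Ser) : Set where
  constructor recurrence
  field step : ∀ k → 1-X *S u (suc k) ≋ a *S u k +S b *S lag zeroS m u k +S e k

Recurrence-unique : ∀ {m a b e u v} → Recurrence m a b e u → Recurrence m a b e v →
                    u 0 ≋ v 0 → ∀ k → u k ≋ v k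
Recurrence-unique {m} {a} {b} {e} {u} {v} (recurrence rec-u) (recurrence rec-v) u₀≋v₀ = <-rec _ agree
  where
  agree : ∀ k → (∀ {j} → j < k → u j ≋ v j) → u k ≋ v k
  agree zero    _  = u₀≋v₀
  agree (suc k) ih = begin
    u (suc k)                                               ≈⟨ cancel-1-X (rec-u k) ⟩
    geom *S (a *S u k +S b *S lag zeroS m u k +S e k)       ≈⟨ *S-congˡ geom (+S-congʳ (e k) (+S-cong (*S-congˡ a (ih ℕP.≤-refl))
                                                                 (*S-congˡ b (lag-cong m k (λ j j≤k → ih (s≤s j≤k)))))) ⟩
    geom *S (a *S v k +S b *S lag zeroS m v k +S e k)       ≈⟨ cancel-1-X (rec-v k) ⟨
    v (suc k)                                               ∎

lag-weighted : ∀ (f : ℕ → Ser) s u → (∀ k → f (suc k) *S s ≋ f k) →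
               ∀ m k → f k *S (powS s m *S lag zeroS m u k) ≋ lag zeroS m (λ j → f j *S u j) k
lag-weighted f s u fs≋f zero    k       = *S-congˡ (f k) (ℤX.*S-identityˡ (u k))
lag-weighted f s u fs≋f (suc m) zero    =
  solve 2 (λ f p → f :* (p :* con (+ 0)) := con (+ 0)) ≋-refl (f 0) (powS s (suc m))
lag-weighted f s u fs≋f (suc m) (suc k) = begin
    f (suc k) *S ((s *S powS s m) *S lag zeroS m u k)
  ≈⟨ solve 4 (λ f s p l → f :* ((s :* p) :* l) := (f :* s) :* (p :* l)) ≋-refl (f (suc k)) s (powS s m) (lag zeroS m u k) ⟩
    (f (suc k) *S s) *S (powS s m *S lag zeroS m u k)
  ≈⟨ *S-congʳ (powS s m *S lag zeroS m u k) (fs≋f k) ⟩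
    f k *S (powS s m *S lag zeroS m u k)
  ≈⟨ lag-weighted f s u fs≋f m k ⟩
    lag zeroS m (λ j → f j *S u j) k
  ∎

-- The polynomials P_k

X[1-X]^ : ℕ → Ser
X[1-X]^ m = X *S powS 1-X m

module _ (m : ℕ) where

  denom-*S : ∀ a k → Y._*S_ (denom m) a k ≋
             oneS *S a k +S negS oneS *S lag zeroS 1 a k +S X[1-X]^ m *S lag zeroS (suc m) a k
  denom-*S a k = begin
      Y._*S_ (denom m) a k
    ≈⟨ ℤXY.coeff (ℤXY.≋-trans (ℤXY.*S-distribʳ a (Y._+S_ m₀ m₁) m₂) (ℤXY.+S-congʳ (Y._*S_ m₂ a) (ℤXY.*S-distribʳ a m₀ m₁))) k ⟩
      Y._*S_ (Y.mono oneS 0) a k +S Y._*S_ (Y.mono (negS oneS) 1) a k +S Y._*S_ (Y.mono (X[1-X]^ m) (suc m)) a k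
    ≈⟨ +S-cong (+S-cong (ℤXY.mono-*S-lag oneS 0 a k) (ℤXY.mono-*S-lag (negS oneS) 1 a k))
               (ℤXY.mono-*S-lag (X[1-X]^ m) (suc m) a k) ⟩
      oneS *S a k +S negS oneS *S lag zeroS 1 a k +S X[1-X]^ m *S lag zeroS (suc m) a k
    ∎
    where
    m₀ = Y.mono oneS 0
    m₁ = Y.mono (negS oneS) 1
    m₂ = Y.mono (X[1-X]^ m) (suc m)

  denom-*S-zero : ∀ a → Y._*S_ (denom m) a 0 ≋ a 0
  denom-*S-zero a = ≋-trans (denom-*S a 0)
    (solve 2 (λ a c → con (+ 1) :* a :+ (:- con (+ 1)) :* con (+ 0) :+ c :* con (+ 0) := a) ≋-refl (a 0) (X[1-X]^ m))

  denom-*S-suc : ∀ a k → Y._*S_ (denom m) a (suc k) ≋ a (suc k) +S negS (a k) +S X[1-X]^ m *S lag zeroS m a k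
  denom-*S-suc a k = ≋-trans (denom-*S a (suc k))
    (solve 4 (λ a₁ a₀ c l → con (+ 1) :* a₁ :+ (:- con (+ 1)) :* a₀ :+ c :* l := a₁ :- a₀ :+ c :* l) ≋-refl
       (a (suc k)) (a k) (X[1-X]^ m) (lag zeroS m a k))

  denom-*S-P : Y._*S_ (denom m) (P m) ℤXY.≋ numer
  denom-*S-P =
    ℤXY.≋-trans (ℤXY.*S-comm D (Y._*S_ numer b)) (ℤXY.≋-trans (ℤXY.*S-assoc numer b D)
      (ℤXY.≋-trans (ℤXY.*S-congˡ numer (ℤXY.≋-trans (ℤXY.*S-comm b D) (ℤXY.*S-invS D D₀≋1)))
        (ℤXYRing.*-identityʳ numer)))
    where
    D = denom m
    b = Y.invS D
    D₀≋1 : D 0 ≋ oneS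
    D₀≋1 = mk≋ λ n → ≡.trans (ZP.+-identityʳ _) (ZP.+-identityʳ _)

  P-zero : P m 0 ≋ oneS
  P-zero = ≋-trans (≋-sym (denom-*S-zero (P m))) (≋-trans (ℤXY.coeff denom-*S-P 0) (mk≋ λ n → ZP.+-identityʳ _))

  P-suc : ∀ k → P m (suc k) ≋ P m k +S negS (X[1-X]^ m *S lag zeroS m (P m) k) +S numer (suc k)
  P-suc k = begin
      P m (suc k)
    ≈⟨ solve 3 (λ p₁ p₀ t → p₁ := (p₁ :- p₀ :+ t) :+ p₀ :- t) ≋-refl (P m (suc k)) (P m k) t ⟩
      (P m (suc k) +S negS (P m k) +S t) +S P m k +S negS t
    ≈⟨ +S-congʳ (negS t) (+S-congʳ (P m k) (≋-trans (≋-sym (denom-*S-suc (P m) k)) (ℤXY.coeff denom-*S-P (suc k)))) ⟩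
      numer (suc k) +S P m k +S negS t
    ≈⟨ solve 3 (λ n p₀ t → n :+ p₀ :- t := p₀ :- t :+ n) ≋-refl (numer (suc k)) (P m k) t ⟩
      P m k +S negS t +S numer (suc k)
    ∎
    where t = X[1-X]^ m *S lag zeroS m (P m) k

  P-one : 1 ≤ m → P m 1 ≋ X
  P-one 1≤m = begin
      P m 1
    ≈⟨ P-suc 0 ⟩
      P m 0 +S negS (X[1-X]^ m *S lag zeroS m (P m) 0) +S numer 1
    ≈⟨ +S-congʳ (numer 1) (+S-cong P-zero (negS-cong (*S-congˡ (X[1-X]^ m) (ℤX.≡⇒≋ (lag-< zeroS (P m) 1≤m))))) ⟩
      oneS +S negS (X[1-X]^ m *S zeroS) +S (zeroS +S (X +S negS oneS))
    ≈⟨ solve 2 (λ c x → con (+ 1) :- c :* con (+ 0) :+ (con (+ 0) :+ (x :- con (+ 1))) := x) ≋-refl (X[1-X]^ m) X ⟩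
      X
    ∎

  P-small : ∀ k → 1 ≤ k → k ≤ m → P m k ≋ X
  P-small (suc zero)    _ 1≤m   = P-one 1≤m
  P-small (suc (suc k)) _ 2+k≤m = begin
      P m (suc (suc k))
    ≈⟨ P-suc (suc k) ⟩
      P m (suc k) +S negS (X[1-X]^ m *S lag zeroS m (P m) (suc k)) +S numer (suc (suc k))
    ≈⟨ +S-congʳ (numer (suc (suc k))) (+S-congˡ (P m (suc k))
         (negS-cong (*S-congˡ (X[1-X]^ m) (ℤX.≡⇒≋ (lag-< zeroS (P m) 2+k≤m))))) ⟩
      P m (suc k) +S negS (X[1-X]^ m *S zeroS) +S zeroS
    ≈⟨ solve 2 (λ p c → p :- c :* con (+ 0) :+ con (+ 0) := p) ≋-refl (P m (suc k)) (X[1-X]^ m) ⟩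
      P m (suc k)
    ≈⟨ P-small (suc k) (s≤s z≤n) (ℕP.<⇒≤ 2+k≤m) ⟩
      X
    ∎

  Pℤ-lag : ∀ j k → Pℤ m (+ k ℤ.- + j) ≡ lag zeroS j (P m) k
  Pℤ-lag j k = ≡.trans (≡.cong (Pℤ m) (ZP.m-n≡m⊖n k j)) (Pℤ-⊖ j k)
    where
    Pℤ-⊖ : ∀ j k → Pℤ m (k ℤ.⊖ j) ≡ lag zeroS j (P m) k
    Pℤ-⊖ zero    k       = ≡.refl
    Pℤ-⊖ (suc j) zero    = ≡.refl
    Pℤ-⊖ (suc j) (suc k) = ≡.trans (≡.cong (Pℤ m) (ZP.[1+m]⊖[1+n]≡m⊖n k j)) (Pℤ-⊖ j k)

  P-recurrence : ∀ k → 2 ≤ k →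
    P m k ≋ P m (k ∸ 1) +S negS (X *S powS 1-X m *S Pℤ m (+ k ℤ.- + (m ℕ.+ 1)))
  P-recurrence (suc zero)    (s≤s ())
  P-recurrence (suc (suc k)) _ = begin
      P m (suc (suc k))
    ≈⟨ P-suc (suc k) ⟩
      P m (suc k) +S negS (X[1-X]^ m *S lag zeroS m (P m) (suc k)) +S numer (suc (suc k))
    ≈⟨ mk≋ (λ n → ZP.+-identityʳ _) ⟩
      P m (suc k) +S negS (X[1-X]^ m *S lag zeroS m (P m) (suc k))
    ≈⟨ +S-congˡ (P m (suc k)) (negS-cong (*S-congˡ (X[1-X]^ m) (ℤX.≡⇒≋ (≡.sym lag≡Pℤ)))) ⟩
      P m (suc k) +S negS (X[1-X]^ m *S Pℤ m (+ suc (suc k) ℤ.- + (m ℕ.+ 1)))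
    ∎
    where
    lag≡Pℤ : Pℤ m (+ suc (suc k) ℤ.- + (m ℕ.+ 1)) ≡ lag zeroS m (P m) (suc k)
    lag≡Pℤ rewrite ℕP.+-comm m 1 = Pℤ-lag (suc m) (suc (suc k))

-- Degrees and reciprocal polynomials

Deg≤ : Ser → ℕ → Set
Deg≤ a N = ∀ i → N < i → a i ≡ + 0

Deg≤-cong : ∀ {a b} N → a ≋ b → Deg≤ a N → Deg≤ b N
Deg≤-cong N a≋b deg-a i N<i = ≡.trans (≡.sym (coeff a≋b i)) (deg-a i N<i)

Deg≤-weaken : ∀ {a} {N N′} → N ≤ N′ → Deg≤ a N → Deg≤ a N′
Deg≤-weaken N≤N′ deg-a i N′<i = deg-a i (ℕP.≤-<-trans N≤N′ N′<i)

Deg≤-+ : ∀ {a b} N → Deg≤ a N → Deg≤ b N → Deg≤ (a +S b) N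
Deg≤-+ N deg-a deg-b i N<i = ≡.cong₂ ℤ._+_ (deg-a i N<i) (deg-b i N<i)

Deg≤-neg : ∀ {a} N → Deg≤ a N → Deg≤ (negS a) N
Deg≤-neg N deg-a i N<i = ≡.cong ℤ.-_ (deg-a i N<i)

Deg≤-X : ∀ {a} N → Deg≤ a N → Deg≤ (X *S a) (suc N)
Deg≤-X {a} N deg-a (suc i) (s≤s N<i) = ≡.trans (X-*S-suc a i) (deg-a i N<i)

Deg≤-1-X : ∀ {a} N → Deg≤ a N → Deg≤ (1-X *S a) (suc N)
Deg≤-1-X {a} N deg-a =
  Deg≤-cong (suc N) (≋-sym (1-X-*S a)) (Deg≤-+ (suc N) (Deg≤-weaken (ℕP.n≤1+n N) deg-a) (Deg≤-neg (suc N) (Deg≤-X N deg-a)))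

Deg≤-lag : ∀ (u : ℕ → Ser) m k → (∀ j → j ≤ k → Deg≤ (u j) j) → Deg≤ (powS 1-X m *S lag zeroS m u k) k
Deg≤-lag u zero    k       deg-u = Deg≤-cong k (≋-sym (ℤX.*S-identityˡ (u k))) (deg-u k ℕP.≤-refl)
Deg≤-lag u (suc m) zero    deg-u i _ = coeff (ℤXRing.zeroʳ (powS 1-X (suc m))) i
Deg≤-lag u (suc m) (suc k) deg-u =
  Deg≤-cong (suc k) (≋-sym (*S-assoc 1-X (powS 1-X m) (lag zeroS m u k)))
    (Deg≤-1-X k (Deg≤-lag u m k (λ j j≤k → deg-u j (ℕP.m≤n⇒m≤1+n j≤k))))

numer-Deg≤ : ∀ k → Deg≤ (numer (suc k)) 1
numer-Deg≤ zero    (suc zero)    (s≤s ())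
numer-Deg≤ zero    (suc (suc i)) _ = ≡.refl
numer-Deg≤ (suc k) i             _ = ≡.refl

P-Deg≤ : ∀ m k → Deg≤ (P m k) k
P-Deg≤ m = <-rec _ deg
  where
  deg : ∀ k → (∀ {j} → j < k → Deg≤ (P m j) j) → Deg≤ (P m k) k
  deg zero    _  = Deg≤-cong 0 (≋-sym (P-zero m)) λ { (suc i) _ → ≡.refl }
  deg (suc k) ih = Deg≤-cong (suc k) (≋-sym (P-suc m k))
    (Deg≤-+ (suc k) (Deg≤-+ (suc k) (Deg≤-weaken (ℕP.n≤1+n k) (ih ℕP.≤-refl))
                                    (Deg≤-neg (suc k) (Deg≤-cong (suc k) (≋-sym (*S-assoc X (powS 1-X m) l))
                                      (Deg≤-X k (Deg≤-lag (P m) m k (λ j j≤k → ih (s≤s j≤k)))))))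
                    (Deg≤-weaken (s≤s z≤n) (numer-Deg≤ k)))
    where l = lag zeroS m (P m) k

recip-cong : ∀ k {a b} → a ≋ b → recip k a ≋ recip k b
recip-cong k a≋b = mk≋ λ j → ≡.cong (λ t → if j ≤ᵇ suc k then t else + 0) (coeff a≋b (suc k ∸ j))

recip-+ : ∀ k a b → recip k (a +S b) ≋ recip k a +S recip k b
recip-+ k a b = mk≋ λ j → if-+ (j ≤ᵇ suc k)
  where
  if-+ : ∀ {x y} c → (if c then x ℤ.+ y else + 0) ≡ (if c then x else + 0) ℤ.+ (if c then y else + 0)
  if-+ true  = ≡.refl
  if-+ false = ≡.refl

recip-neg : ∀ k a → recip k (negS a) ≋ negS (recip k a)
recip-neg k a = mk≋ λ j → if-neg (j ≤ᵇ suc k)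
  where
  if-neg : ∀ {x} c → (if c then ℤ.- x else + 0) ≡ ℤ.- (if c then x else + 0)
  if-neg true  = ≡.refl
  if-neg false = ≡.refl

recip-zero : ∀ k → recip k zeroS ≋ zeroS
recip-zero k = mk≋ λ j → if-zero (j ≤ᵇ suc k)
  where
  if-zero : ∀ c → (if c then + 0 else + 0) ≡ + 0
  if-zero true  = ≡.refl
  if-zero false = ≡.refl

recip-shift : ∀ k a j → recip (suc k) a (suc j) ≡ recip k a j
recip-shift k a zero    = ≡.refl
recip-shift k a (suc j) = ≡.refl

recip-X : ∀ k a → recip (suc k) (X *S a) ≋ recip k a
recip-X k a = mk≋ (reduce k)
  where
  reduce : ∀ k j → recip (suc k) (X *S a) j ≡ recip k a j
  reduce k       zero                = X-*S-suc a (suc k)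
  reduce zero    (suc zero)          = X-*S-suc a 0
  reduce zero    (suc (suc zero))    = X-*S-zero a
  reduce zero    (suc (suc (suc j))) = ≡.refl
  reduce (suc k) (suc j)             =
    ≡.trans (recip-shift (suc k) (X *S a) j) (≡.trans (reduce k j) (≡.sym (recip-shift k a j)))

recip-suc : ∀ k {a} → Deg≤ a (suc k) → recip (suc k) a ≋ X *S recip k a
recip-suc k {a} deg-a = mk≋ λ where
  zero    → ≡.trans (deg-a (suc (suc k)) ℕP.≤-refl) (≡.sym (X-*S-zero (recip k a)))
  (suc j) → ≡.trans (recip-shift k a j) (≡.sym (X-*S-suc (recip k a) j))

recip-1-X : ∀ k {a} → Deg≤ a (suc k) → recip (suc k) (1-X *S a) ≋ negS 1-X *S recip k a
recip-1-X k {a} deg-a = begin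
    recip (suc k) (1-X *S a)
  ≈⟨ recip-cong (suc k) (1-X-*S a) ⟩
    recip (suc k) (a +S negS (X *S a))
  ≈⟨ ≋-trans (recip-+ (suc k) a (negS (X *S a))) (+S-congˡ (recip (suc k) a) (recip-neg (suc k) (X *S a))) ⟩
    recip (suc k) a +S negS (recip (suc k) (X *S a))
  ≈⟨ +S-cong (recip-suc k deg-a) (negS-cong (recip-X k a)) ⟩
    X *S recip k a +S negS (recip k a)
  ≈⟨ solve 2 (λ x r → x :* r :- r := (:- (con (+ 1) :- x)) :* r) ≋-refl X (recip k a) ⟩
    negS 1-X *S recip k a
  ∎

recip-lag : ∀ (u : ℕ → Ser) m k → (∀ j → j ≤ k → Deg≤ (u j) j) →
            recip k (powS 1-X m *S lag zeroS m u k) ≋ powS (negS 1-X) m *S lag zeroS m (λ j → recip j (u j)) k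
recip-lag u zero    k       deg-u =
  ≋-trans (recip-cong k (ℤX.*S-identityˡ (u k))) (≋-sym (ℤX.*S-identityˡ (recip k (u k))))
recip-lag u (suc m) zero    deg-u =
  ≋-trans (recip-cong 0 (ℤXRing.zeroʳ (powS 1-X (suc m))))
          (≋-trans (recip-zero 0) (≋-sym (ℤXRing.zeroʳ (powS (negS 1-X) (suc m)))))
recip-lag u (suc m) (suc k) deg-u = begin
    recip (suc k) ((1-X *S powS 1-X m) *S l)
  ≈⟨ recip-cong (suc k) (*S-assoc 1-X (powS 1-X m) l) ⟩
    recip (suc k) (1-X *S (powS 1-X m *S l))
  ≈⟨ recip-1-X k (Deg≤-weaken (ℕP.n≤1+n k) (Deg≤-lag u m k deg-u′)) ⟩
    negS 1-X *S recip k (powS 1-X m *S l)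
  ≈⟨ *S-congˡ (negS 1-X) (recip-lag u m k deg-u′) ⟩
    negS 1-X *S (powS (negS 1-X) m *S lag zeroS m (λ j → recip j (u j)) k)
  ≈⟨ *S-assoc (negS 1-X) (powS (negS 1-X) m) (lag zeroS m (λ j → recip j (u j)) k) ⟨
    (negS 1-X *S powS (negS 1-X) m) *S lag zeroS m (λ j → recip j (u j)) k
  ∎
  where
  l = lag zeroS m u k
  deg-u′ : ∀ j → j ≤ k → Deg≤ (u j) j
  deg-u′ j j≤k = deg-u j (ℕP.m≤n⇒m≤1+n j≤k)

recip-P-suc : ∀ m k → recip (suc k) (P m (suc k)) ≋
  X *S recip k (P m k) +S negS (powS (negS 1-X) m *S lag zeroS m (λ j → recip j (P m j)) k) +S recip (suc k) (numer (suc k))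
recip-P-suc m k = begin
    recip (suc k) (P m (suc k))
  ≈⟨ recip-cong (suc k) (P-suc m k) ⟩
    recip (suc k) (P m k +S negS (X[1-X]^ m *S l) +S numer (suc k))
  ≈⟨ ≋-trans (recip-+ (suc k) (P m k +S negS t) (numer (suc k))) (+S-congʳ (recip (suc k) (numer (suc k)))
       (≋-trans (recip-+ (suc k) (P m k) (negS t)) (+S-congˡ (recip (suc k) (P m k)) (recip-neg (suc k) t)))) ⟩
    recip (suc k) (P m k) +S negS (recip (suc k) (X[1-X]^ m *S l)) +S recip (suc k) (numer (suc k))
  ≈⟨ +S-congʳ (recip (suc k) (numer (suc k))) (+S-cong
       (recip-suc k (Deg≤-weaken (ℕP.n≤1+n k) (P-Deg≤ m k)))
       (negS-cong (≋-trans (recip-cong (suc k) (*S-assoc X (powS 1-X m) l)) (recip-X k (powS 1-X m *S l))))) ⟩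
    X *S recip k (P m k) +S negS (recip k (powS 1-X m *S l)) +S recip (suc k) (numer (suc k))
  ≈⟨ +S-congʳ (recip (suc k) (numer (suc k))) (+S-congˡ (X *S recip k (P m k))
       (negS-cong (recip-lag (P m) m k (λ j _ → P-Deg≤ m j)))) ⟩
    X *S recip k (P m k) +S negS (powS (negS 1-X) m *S lag zeroS m (λ j → recip j (P m j)) k) +S recip (suc k) (numer (suc k))
  ∎
  where
  l = lag zeroS m (P m) k
  t = X[1-X]^ m *S l

-- Powers of p_m

pm-suc : ∀ m n → pm (suc m) (suc n) ≡ pm m n
pm-suc m zero    = ≡.refl
pm-suc m (suc n) = ≡.refl

pm-step : ∀ m n → pm m (suc n) ℤ.- pm m n ≡ ℤ.- mono (+ 1) m n
pm-step zero    zero    = ≡.refl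
pm-step zero    (suc n) = ≡.refl
pm-step (suc m) zero    = ≡.refl
pm-step (suc m) (suc n) rewrite pm-suc m (suc n) | pm-suc m n = pm-step m n

1-X-*S-pm : ∀ m → 1-X *S pm m ≋ oneS +S negS (mono (+ 1) (suc m))
1-X-*S-pm m = mk≋ λ where
  zero    → 1-X-*S-zero (pm m)
  (suc n) → ≡.trans (1-X-*S-suc (pm m) n) (≡.trans (pm-step m n) (≡.sym (ZP.+-identityˡ _)))

1-Xᵐ⁺¹-*S-suc : ∀ m a k → ((oneS +S negS (mono (+ 1) (suc m))) *S a) (suc k) ≡ a (suc k) ℤ.- lag (+ 0) m a k
1-Xᵐ⁺¹-*S-suc m a k =
  ≡.trans (coeff (solve 2 (λ t a → (con (+ 1) :- t) :* a := a :- t :* a) ≋-refl t a) (suc k))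
          (≡.cong (λ z → a (suc k) ℤ.- z) (≡.trans (ℤX.mono-*S-lag (+ 1) (suc m) a (suc k)) (ZP.*-identityˡ _)))
  where t = mono (+ 1) (suc m)

pm^ : ℕ → ℕ → Ser
pm^ m n = powS (pm m) n

pm^-zero : ∀ m n → pm^ m n 0 ≡ + 1
pm^-zero m zero    = ≡.refl
pm^-zero m (suc n) = ≡.trans (ZP.*-identityˡ _) (pm^-zero m n)

1-X-*S-pm^ : ∀ m n → 1-X *S pm^ m (suc n) ≋ (oneS +S negS (mono (+ 1) (suc m))) *S pm^ m n
1-X-*S-pm^ m n = ≋-trans (≋-sym (*S-assoc 1-X (pm m) (pm^ m n))) (*S-congʳ (pm^ m n) (1-X-*S-pm m))

pm^-step : ∀ m n k → pm^ m (suc n) (suc k) ℤ.- pm^ m (suc n) k ≡ pm^ m n (suc k) ℤ.- lag (+ 0) m (pm^ m n) k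
pm^-step m n k = ≡.trans (≡.sym (1-X-*S-suc (pm^ m (suc n)) k))
                         (≡.trans (coeff (1-X-*S-pm^ m n) (suc k)) (1-Xᵐ⁺¹-*S-suc m (pm^ m n) k))

pm^-inverse : ℕ → ℕ → Ser
pm^-inverse m n = invS (pm^ m n)

pm^-*S-inverse : ∀ m n → pm^ m n *S pm^-inverse m n ≋ oneS
pm^-*S-inverse m n = *S-invS (pm^ m n) (pm^-zero m n)

pm^-inverse-zero : ∀ m → pm^-inverse m 0 ≋ oneS
pm^-inverse-zero m = ≋-trans (≋-sym (ℤX.*S-identityˡ (pm^-inverse m 0))) (pm^-*S-inverse m 0)

pm^-inverse-*S-pm : ∀ m n → pm^-inverse m (suc n) *S pm m ≋ pm^-inverse m n
pm^-inverse-*S-pm m n = begin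
    q′ *S pm m
  ≈⟨ ℤXRing.*-identityʳ (q′ *S pm m) ⟨
    (q′ *S pm m) *S oneS
  ≈⟨ *S-congˡ (q′ *S pm m) (pm^-*S-inverse m n) ⟨
    (q′ *S pm m) *S (pm^ m n *S q)
  ≈⟨ solve 4 (λ q′ p b q → (q′ :* p) :* (b :* q) := ((p :* b) :* q′) :* q) ≋-refl q′ (pm m) (pm^ m n) q ⟩
    (pm^ m (suc n) *S q′) *S q
  ≈⟨ ≋-trans (*S-congʳ q (pm^-*S-inverse m (suc n))) (ℤX.*S-identityˡ q) ⟩
    q
  ∎
  where
  q = pm^-inverse m n
  q′ = pm^-inverse m (suc n)

pm^-inverse-step : ∀ m n k →
  pm^-inverse m n (suc k) ℤ.- pm^-inverse m n k ≡ pm^-inverse m (suc n) (suc k) ℤ.- lag (+ 0) m (pm^-inverse m (suc n)) k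
pm^-inverse-step m n k = ≡.trans (≡.sym (1-X-*S-suc (pm^-inverse m n) k))
  (≡.trans (coeff 1-X-*S-q (suc k)) (1-Xᵐ⁺¹-*S-suc m q′ k))
  where
  q′ = pm^-inverse m (suc n)
  1-X-*S-q : 1-X *S pm^-inverse m n ≋ (oneS +S negS (mono (+ 1) (suc m))) *S q′
  1-X-*S-q = begin
    1-X *S pm^-inverse m n     ≈⟨ *S-congˡ 1-X (pm^-inverse-*S-pm m n) ⟨
    1-X *S (q′ *S pm m)        ≈⟨ solve 3 (λ l q p → l :* (q :* p) := (l :* p) :* q) ≋-refl 1-X q′ (pm m) ⟩
    (1-X *S pm m) *S q′        ≈⟨ *S-congʳ q′ (1-X-*S-pm m) ⟩
    (oneS +S negS (mono (+ 1) (suc m))) *S q′ ∎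

-- F⁺

swap-differences : ∀ a b c d → a ℤ.- b ≡ c ℤ.- d → a ℤ.- c ≡ b ℤ.- d
swap-differences a b c d a-b≡c-d = ≡.trans (split a b c) (≡.trans (≡.cong (ℤ._+ (b ℤ.- c)) a-b≡c-d) (merge b c d))
  where
  split : ∀ a b c → a ℤ.- c ≡ (a ℤ.- b) ℤ.+ (b ℤ.- c)
  split = solve-∀
  merge : ∀ b c d → (c ℤ.- d) ℤ.+ (b ℤ.- c) ≡ b ℤ.- d
  merge = solve-∀

1-X-*S-Fplus-zero : ∀ m → 1-X *S Fplus m 0 ≋ oneS
1-X-*S-Fplus-zero m = mk≋ λ where
  zero    → ≡.refl
  (suc n) → ≡.trans (1-X-*S-suc (Fplus m 0) n) (≡.cong₂ ℤ._-_ (pm^-zero m (suc n)) (pm^-zero m n))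

Fplus-recurrence : ∀ m → Recurrence m oneS (negS X) (λ k → negS (δ k)) (Fplus m)
Fplus-recurrence m = recurrence step
  where
  step : ∀ k → 1-X *S Fplus m (suc k) ≋ oneS *S Fplus m k +S negS X *S lag zeroS m (Fplus m) k +S negS (δ k)
  step k = ≋-trans (mk≋ coefficient)
    (solve 4 (λ f x l d → f :- x :* l :+ (:- d) := con (+ 1) :* f :+ (:- x) :* l :+ (:- d)) ≋-refl (Fplus m k) X l (δ k))
    where
    l = lag zeroS m (Fplus m) k
    coefficient : ∀ n → (1-X *S Fplus m (suc k)) n ≡ (Fplus m k +S negS (X *S l) +S negS (δ k)) n
    coefficient zero rewrite X-*S-zero l = δ-cancels k
      where
      δ-cancels : ∀ k → + 0 ≡ oneS k ℤ.+ + 0 ℤ.+ ℤ.- δ k 0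
      δ-cancels zero    = ≡.refl
      δ-cancels (suc k) = ≡.refl
    coefficient (suc n) rewrite X-*S-suc l n | lag-coeff m (Fplus m) k n | δ-suc k n =
      ≡.trans (1-X-*S-suc (Fplus m (suc k)) n)
              (≡.trans (swap-differences (pm^ m (suc n) (suc k)) (pm^ m (suc n) k) (pm^ m n (suc k))
                                         (lag (+ 0) m (pm^ m n) k) (pm^-step m n k))
                       (≡.sym (ZP.+-identityʳ _)))

geom-pow-step : ∀ k → powS geom (suc (suc k)) *S 1-X ≋ powS geom (suc k)
geom-pow-step k = begin
  (geom *S G) *S 1-X    ≈⟨ solve 3 (λ g G l → (g :* G) :* l := (l :* g) :* G) ≋-refl geom G 1-X ⟩
  (1-X *S geom) *S G    ≈⟨ *S-congʳ G 1-X-*S-geom ⟩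
  oneS *S G             ≈⟨ ℤX.*S-identityˡ G ⟩
  G                     ∎
  where G = powS geom (suc k)

geom-pow-numer : ∀ k → powS geom (suc k) *S numer (suc k) ≋ negS (δ k)
geom-pow-numer zero    = begin
    (geom *S oneS) *S (zeroS +S (X +S negS oneS))
  ≈⟨ solve 2 (λ g x → (g :* con (+ 1)) :* (con (+ 0) :+ (x :- con (+ 1))) := :- ((con (+ 1) :- x) :* g)) ≋-refl geom X ⟩
    negS (1-X *S geom)
  ≈⟨ negS-cong 1-X-*S-geom ⟩
    negS oneS
  ∎
geom-pow-numer (suc k) = ≋-trans (*S-congˡ (powS geom (suc (suc k))) numer≋0)
                                 (solve 1 (λ g → g :* con (+ 0) := :- con (+ 0)) ≋-refl (powS geom (suc (suc k))))
  where
  numer≋0 : numer (suc (suc k)) ≋ zeroS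
  numer≋0 = mk≋ λ _ → ≡.refl

geom-weighted-P-recurrence : ∀ m → Recurrence m oneS (negS X) (λ k → negS (δ k)) (λ k → powS geom (suc k) *S P m k)
geom-weighted-P-recurrence m = recurrence λ k → let G = powS geom (suc k) ; l = lag zeroS m (P m) k in begin
    1-X *S ((geom *S G) *S P m (suc k))
  ≈⟨ solve 4 (λ l g G p → l :* ((g :* G) :* p) := (l :* g) :* (G :* p)) ≋-refl 1-X geom G (P m (suc k)) ⟩
    (1-X *S geom) *S (G *S P m (suc k))
  ≈⟨ ≋-trans (*S-congʳ (G *S P m (suc k)) 1-X-*S-geom) (ℤX.*S-identityˡ _) ⟩
    G *S P m (suc k)
  ≈⟨ *S-congˡ G (P-suc m k) ⟩
    G *S (P m k +S negS (X[1-X]^ m *S l) +S numer (suc k))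
  ≈⟨ solve 6 (λ G p x Lm l n → G :* (p :- (x :* Lm) :* l :+ n) :=
                               con (+ 1) :* (G :* p) :+ (:- x) :* (G :* (Lm :* l)) :+ G :* n)
       ≋-refl G (P m k) X (powS 1-X m) l (numer (suc k)) ⟩
    oneS *S (G *S P m k) +S negS X *S (G *S (powS 1-X m *S l)) +S G *S numer (suc k)
  ≈⟨ +S-cong (+S-congˡ (oneS *S (G *S P m k))
               (*S-congˡ (negS X) (lag-weighted (λ j → powS geom (suc j)) 1-X (P m) geom-pow-step m k)))
             (geom-pow-numer k) ⟩
    oneS *S (G *S P m k) +S negS X *S lag zeroS m (λ j → powS geom (suc j) *S P m j) k +S negS (δ k)
  ∎

Fplus-closed-form : ∀ m k → Fplus m k ≋ powS geom (suc k) *S P m k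
Fplus-closed-form m = Recurrence-unique (Fplus-recurrence m) (geom-weighted-P-recurrence m) (begin
  Fplus m 0                  ≈⟨ cancel-1-X (1-X-*S-Fplus-zero m) ⟩
  geom *S oneS               ≈⟨ ℤXRing.*-identityʳ (geom *S oneS) ⟨
  (geom *S oneS) *S oneS     ≈⟨ *S-congˡ (geom *S oneS) (P-zero m) ⟨
  powS geom 1 *S P m 0       ∎)

-- F⁻

[-1]^ : ℕ → ℤ
[-1]^ k = -[1+ 0 ] ℤ.^ k

alternating-geom-pow : ℕ → Ser
alternating-geom-pow k = const ([-1]^ k) *S powS geom (suc k)

alternating-geom-pow-step : ∀ k → alternating-geom-pow (suc k) *S negS 1-X ≋ alternating-geom-pow k
alternating-geom-pow-step k = begin
    (const ([-1]^ (suc k)) *S (geom *S G)) *S negS 1-X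
  ≈⟨ *S-congʳ (negS 1-X) (*S-congʳ (geom *S G) (const-* -[1+ 0 ] ([-1]^ k))) ⟩
    ((const -[1+ 0 ] *S c) *S (geom *S G)) *S negS 1-X
  ≈⟨ solve 4 (λ c g G l → ((con -[1+ 0 ] :* c) :* (g :* G)) :* (:- l) := (l :* g) :* (c :* G)) ≋-refl c geom G 1-X ⟩
    (1-X *S geom) *S (c *S G)
  ≈⟨ ≋-trans (*S-congʳ (c *S G) 1-X-*S-geom) (ℤX.*S-identityˡ (c *S G)) ⟩
    c *S G
  ∎
  where
  c = const ([-1]^ k)
  G = powS geom (suc k)

1-X-*S-alternating-geom-pow : ∀ k → 1-X *S alternating-geom-pow (suc k) ≋ negS (alternating-geom-pow k)
1-X-*S-alternating-geom-pow k = ≋-trans (solve 2 (λ l f → l :* f := :- (f :* (:- l))) ≋-refl 1-X (alternating-geom-pow (suc k)))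
                                         (negS-cong (alternating-geom-pow-step k))

recip-numer-one : recip 1 (numer 1) ≋ X *S 1-X
recip-numer-one = mk≋ λ where
  zero                → ≡.sym (X-*S-zero 1-X)
  (suc zero)          → ≡.sym (X-*S-suc 1-X 0)
  (suc (suc zero))    → ≡.sym (X-*S-suc 1-X 1)
  (suc (suc (suc j))) → ≡.sym (X-*S-suc 1-X (suc (suc j)))

alternating-geom-pow-recip-numer : ∀ k → alternating-geom-pow k *S recip (suc k) (numer (suc k)) ≋ X *S δ k
alternating-geom-pow-recip-numer zero    = begin
    (const (+ 1) *S (geom *S oneS)) *S recip 1 (numer 1)
  ≈⟨ *S-cong (*S-congʳ (geom *S oneS) (≋-sym oneS≋const)) recip-numer-one ⟩
    (oneS *S (geom *S oneS)) *S (X *S 1-X)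
  ≈⟨ solve 3 (λ g x l → (con (+ 1) :* (g :* con (+ 1))) :* (x :* l) := x :* (l :* g)) ≋-refl geom X 1-X ⟩
    X *S (1-X *S geom)
  ≈⟨ *S-congˡ X 1-X-*S-geom ⟩
    X *S oneS
  ∎
alternating-geom-pow-recip-numer (suc k) =
  ≋-trans (*S-congˡ (alternating-geom-pow (suc k)) (≋-trans (recip-cong (suc (suc k)) numer≋0) (recip-zero (suc (suc k)))))
          (solve 2 (λ f x → f :* con (+ 0) := x :* con (+ 0)) ≋-refl (alternating-geom-pow (suc k)) X)
  where
  numer≋0 : numer (suc (suc k)) ≋ zeroS
  numer≋0 = mk≋ λ _ → ≡.refl

alternating-weighted-recip-P-recurrence : ∀ m →
  Recurrence m (negS X) oneS (λ k → negS (X *S δ k)) (λ k → alternating-geom-pow k *S recip k (P m k))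
alternating-weighted-recip-P-recurrence m = recurrence step
  where
  R : ℕ → Ser
  R j = recip j (P m j)
  step : ∀ k → 1-X *S (alternating-geom-pow (suc k) *S R (suc k)) ≋
               negS X *S (alternating-geom-pow k *S R k)
               +S oneS *S lag zeroS m (λ j → alternating-geom-pow j *S R j) k +S negS (X *S δ k)
  step k = begin
      1-X *S (f′ *S R (suc k))
    ≈⟨ ≋-trans (≋-sym (*S-assoc 1-X f′ (R (suc k)))) (*S-congʳ (R (suc k)) (1-X-*S-alternating-geom-pow k)) ⟩
      negS f *S R (suc k)
    ≈⟨ *S-congˡ (negS f) (recip-P-suc m k) ⟩
      negS f *S (X *S R k +S negS (N *S l) +S ε)
    ≈⟨ solve 6 (λ f x r n l e → (:- f) :* (x :* r :- n :* l :+ e) := (:- x) :* (f :* r) :+ con (+ 1) :* (f :* (n :* l)) :- f :* e)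
         ≋-refl f X (R k) N l ε ⟩
      negS X *S (f *S R k) +S oneS *S (f *S (N *S l)) +S negS (f *S ε)
    ≈⟨ +S-cong (+S-congˡ (negS X *S (f *S R k)) (*S-congˡ oneS
                 (lag-weighted alternating-geom-pow (negS 1-X) R alternating-geom-pow-step m k)))
               (negS-cong (alternating-geom-pow-recip-numer k)) ⟩
      negS X *S (f *S R k) +S oneS *S lag zeroS m (λ j → alternating-geom-pow j *S R j) k +S negS (X *S δ k)
    ∎
    where
    f = alternating-geom-pow k
    f′ = alternating-geom-pow (suc k)
    N = powS (negS 1-X) m
    l = lag zeroS m R k
    ε = recip (suc k) (numer (suc k))

1-X-*S-Fminus-zero : ∀ m → 1-X *S Fminus m 0 ≋ X
1-X-*S-Fminus-zero m = mk≋ coefficient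
  where
  coefficient : ∀ n → (1-X *S Fminus m 0) n ≡ X n
  coefficient zero    = ≡.refl
  coefficient (suc n) = ≡.trans (1-X-*S-suc (Fminus m 0) n) (difference n)
    where
    difference : ∀ n → Fminus m 0 (suc n) ℤ.- Fminus m 0 n ≡ X (suc n)
    difference zero    = ≡.refl
    difference (suc n) = ≡.refl

-- Fminus m k 0 is 0 although p_m(t)^0 = 1; δ makes up the difference.
Fminus-+-δ : ∀ m k n → Fminus m k n ℤ.+ δ k n ≡ pm^-inverse m n k
Fminus-+-δ m k zero    = ≡.trans (ZP.+-identityˡ (δ k 0)) (≡.trans (δ-zero k) (≡.sym (coeff (pm^-inverse-zero m) k)))
Fminus-+-δ m k (suc n) = ≡.trans (≡.cong (λ z → Fminus m k (suc n) ℤ.+ z) (δ-suc k n)) (ZP.+-identityʳ _)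

Fminus-recurrence : ∀ m → Recurrence m (negS X) oneS (λ k → negS (X *S δ k)) (Fminus m)
Fminus-recurrence m = recurrence step
  where
  rearrange : ∀ a c d h e → a ℤ.- (h ℤ.+ e) ≡ c ℤ.- d → c ℤ.- a ≡ ℤ.- h ℤ.+ d ℤ.+ ℤ.- e
  rearrange a c d h e eq = ≡.trans (≡.cong (ℤ._- a) c≡) (collect a h e d)
    where
    cancel : ∀ c d → c ≡ (c ℤ.- d) ℤ.+ d
    cancel = solve-∀
    collect : ∀ a h e d → (a ℤ.- (h ℤ.+ e)) ℤ.+ d ℤ.- a ≡ ℤ.- h ℤ.+ d ℤ.+ ℤ.- e
    collect = solve-∀
    c≡ : c ≡ (a ℤ.- (h ℤ.+ e)) ℤ.+ d
    c≡ = ≡.trans (cancel c d) (≡.cong (ℤ._+ d) (≡.sym eq))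
  step : ∀ k → 1-X *S Fminus m (suc k) ≋ negS X *S Fminus m k +S oneS *S lag zeroS m (Fminus m) k +S negS (X *S δ k)
  step k = ≋-trans (mk≋ coefficient)
    (solve 4 (λ x h l d → :- (x :* h) :+ l :- x :* d := (:- x) :* h :+ con (+ 1) :* l :- x :* d) ≋-refl X (Fminus m k) l (δ k))
    where
    l = lag zeroS m (Fminus m) k
    coefficient : ∀ n → (1-X *S Fminus m (suc k)) n ≡ (negS (X *S Fminus m k) +S l +S negS (X *S δ k)) n
    coefficient zero
      rewrite X-*S-zero (Fminus m k) | X-*S-zero (δ k) | lag-coeff m (Fminus m) k 0 | lag-constant (+ 0) m k = ≡.refl
    coefficient (suc n)
      rewrite X-*S-suc (Fminus m k) n | X-*S-suc (δ k) n | lag-coeff m (Fminus m) k (suc n) =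
      ≡.trans (1-X-*S-suc (Fminus m (suc k)) n)
              (≡.trans (≡.cong (λ z → Fminus m (suc k) (suc n) ℤ.- z) Fminus-suc)
                       (rearrange (pm^-inverse m n (suc k)) (pm^-inverse m (suc n) (suc k))
                                  (lag (+ 0) m (pm^-inverse m (suc n)) k) (Fminus m k n) (δ k n)
                                  (≡.trans (≡.cong (λ b → pm^-inverse m n (suc k) ℤ.- b) (Fminus-+-δ m k n))
                                           (pm^-inverse-step m n k))))
      where
      Fminus-suc : Fminus m (suc k) n ≡ pm^-inverse m n (suc k)
      Fminus-suc = ≡.trans (≡.sym (ZP.+-identityʳ _)) (Fminus-+-δ m (suc k) n)

recip-one : recip 0 oneS ≋ X
recip-one = mk≋ λ { zero → ≡.refl ; (suc zero) → ≡.refl ; (suc (suc j)) → ≡.refl }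

Fminus-closed-form : ∀ m k → Fminus m k ≋ alternating-geom-pow k *S recip k (P m k)
Fminus-closed-form m = Recurrence-unique (Fminus-recurrence m) (alternating-weighted-recip-P-recurrence m) (begin
    Fminus m 0
  ≈⟨ cancel-1-X (1-X-*S-Fminus-zero m) ⟩
    geom *S X
  ≈⟨ solve 2 (λ g x → g :* x := (con (+ 1) :* (g :* con (+ 1))) :* x) ≋-refl geom X ⟩
    (oneS *S (geom *S oneS)) *S X
  ≈⟨ *S-cong (*S-congʳ (geom *S oneS) oneS≋const) (≋-sym (≋-trans (recip-cong 0 (P-zero m)) recip-one)) ⟩
    alternating-geom-pow 0 *S recip 0 (P m 0)
  ∎)

mainTheorem2 : (m : ℕ) → 1 ≤ m →
    ((k : ℕ) → Fplus m k ≈S powS geom (suc k) *S P m k)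
    × ((k : ℕ) → Fminus m k ≈S scaleS (-[1+ 0 ] ^ k) (powS geom (suc k) *S recip k (P m k)))
    × (P m 0 ≈S oneS)
    × (P m 1 ≈S X)
    × ((k : ℕ) → 2 ≤ k →
        P m k ≈S P m (k ∸ 1) +S negS (X *S powS (oneS +S negS X) m *S Pℤ m (+ k - + (m + 1))))
    × ((k : ℕ) → 1 ≤ k → k ≤ m → P m k ≈S X)
mainTheorem2 m 1≤m =
    (λ k → coeff (Fplus-closed-form m k))
  , (λ k → coeff (≋-trans (Fminus-closed-form m k) (≋-trans (*S-assoc (const ([-1]^ k)) (powS geom (suc k)) (recip k (P m k)))
                                                            (const-*S ([-1]^ k) (powS geom (suc k) *S recip k (P m k))))))
  , coeff (P-zero m)
  , coeff (P-one m 1≤m)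
  , (λ k 2≤k → coeff (P-recurrence m k 2≤k))
  , (λ k 1≤k k≤m → coeff (P-small m k 1≤k k≤m))
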